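{- Let $D$ be a finite set and $R\subsetneq S\subseteq D^r$. Then for all $n$, $$\max_{t\in S\setminus R}\mathrm{NRD}(R\mid R\cup\{t\},n)\ \le\ \mathrm{NRD}(R\mid S,n)\ \le\ |D|^r\max_{t\in S\setminus R}\mathrm{NRD}(R\mid R\cup\{t\},n).$$
   Context: For $R\subseteq S\subseteq D^r$, an instance $(X,Y)$ ($X$ a finite set of variables, $Y\subseteq X^r$) is a non-redundant instance of $\mathrm{CSP}(R\mid S)$ if for every $y\in Y$ there is $\sigma:X\to D$ with $\sigma(y')\in R$ for all $y'\in Y\setminus\{y\}$ and $\sigma(y)\in S\setminus R$ ($\sigma$ applied componentwise). $\mathrm{NRD}(R\mid S,n)$ is the maximum $|Y|$ of such an instance with $|X|=n$. -}

module Defs where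

open import Data.Nat using (ℕ; _≤_)
open import Data.Fin using (Fin)
open import Data.Vec using (Vec; map)
open import Data.List using (List; length)
open import Data.List.Membership.Propositional using (_∈_)
open import Data.List.Relation.Unary.Unique.Propositional using (Unique)
open import Data.Product using (Σ; _×_; ∃)
open import Data.Sum using (_⊎_)
open import Relation.Nullary using (¬_)
open import Relation.Binary.PropositionalEquality using (_≡_; _≢_)
open import Level using (0ℓ)
open import Relation.Unary using (Pred)

-- The domain D is Fin d; r-tuples over D are Vec (Fin d) r.
Tuple : ℕ → ℕ → Set
Tuple d r = Vec (Fin d) r

Rel : ℕ → ℕ → Set₁
Rel d r = Pred (Tuple d r) 0ℓ

_∪⟨_⟩ : ∀ {d r} → Rel d r → Tuple d r → Rel d r
(R ∪⟨ t ⟩) u = R u ⊎ u ≡ t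

-- An instance on the variable set X = Fin n: Y ⊆ X^r given as a duplicate-free list.
-- Non-redundancy for CSP(R | S): every constraint y can be the unique violated one.
NonRedundant : ∀ {d r} → Rel d r → Rel d r → (n : ℕ) → List (Vec (Fin n) r) → Set
NonRedundant {d} R S n Y =
  Unique Y ×
  (∀ {y} → y ∈ Y →
     Σ (Fin n → Fin d) λ σ →
       (∀ {y'} → y' ∈ Y → y' ≢ y → R (map σ y')) ×
       S (map σ y) × ¬ R (map σ y))

-- IsNRD R S n m : m = NRD(R | S, n), i.e. m is the maximum size |Y| of a
-- non-redundant instance of CSP(R | S) on n variables.
IsNRD : ∀ {d r} → Rel d r → Rel d r → ℕ → ℕ → Set
IsNRD R S n m =
  (Σ _ λ Y → NonRedundant R S n Y × length Y ≡ m) ×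
  (∀ Y → NonRedundant R S n Y → length Y ≤ m)

-- Lower bound: R ∪ {t} ⊆ S, so an instance that is non-redundant for CSP(R | R ∪ {t}) is
-- non-redundant for CSP(R | S). Upper bound: in a non-redundant instance Y of CSP(R | S),
-- label each constraint y by the tuple t ∈ S ∖ R to which its witness assignment sends it.
-- The constraints labelled t form a non-redundant instance of CSP(R | R ∪ {t}), and since
-- there are only |D|^r labels, one of these classes has at least |Y| / |D|^r elements.
module Submission where

open import Defs
open import Data.Nat using (ℕ; _≤_; _*_; _^_)
open import Data.Product using (Σ; _×_)
open import Relation.Nullary using (¬_)
open import Relation.Unary using (_⊆_)

open import Level using (Level)
open import Data.Nat using (zero; suc; _+_; z≤n)
open import Data.Nat.Properties
  using (+-suc; module ≤-Reasoning; ≤-trans; ≤-total; +-monoˡ-≤; +-monoʳ-≤; *-monoʳ-≤)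
open import Data.Bool using (true; false)
open import Data.Fin using (Fin)
import Data.Fin.Properties as Fin
open import Data.Vec using (Vec; []; _∷_; map)
import Data.Vec.Properties as Vec
open import Data.List using (List; []; _∷_; _++_; length; filter; allFin; cartesianProductWith)
import Data.List as L
open import Data.List.Properties using (length-map; length-++; length-tabulate)
open import Data.List.Membership.Propositional using (_∈_)
open import Data.List.Membership.Propositional.Properties
  using (∈-filter⁻; ∈-allFin; ∈-cartesianProductWith⁺)
open import Data.List.Relation.Unary.Any using (here; there)
import Data.List.Relation.Unary.Unique.Propositional.Properties as Unique
open import Data.List.Relation.Binary.Sublist.Propositional.Properties
  using (filter-⊆; filter⁺; length-mono-≤)
open import Data.Product using (_,_; proj₁; proj₂)
open import Data.Sum using (inj₁; inj₂; [_,_])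
open import Function using (id)
open import Relation.Nullary using (yes; no; does; contradiction)
open import Relation.Unary using (Pred; Decidable)
open import Relation.Unary.Properties using (∁?)
open import Relation.Binary.Definitions using (DecidableEquality)
open import Relation.Binary.PropositionalEquality
  using (_≡_; _≢_; refl; sym; trans; cong; cong₂; subst; module ≡-Reasoning)

private
  variable
    a b c p : Level
    A : Set a
    B : Set b

length-filter-split : {P : Pred A p} (P? : Decidable P) (xs : List A) →
                      length xs ≡ length (filter P? xs) + length (filter (∁? P?) xs)
length-filter-split P? [] = refl
length-filter-split P? (x ∷ xs) with does (P? x)
... | true  = cong suc (length-filter-split P? xs)
... | false = begin
  suc (length xs)                                              ≡⟨ cong suc (length-filter-split P? xs) ⟩
  suc (length (filter P? xs) + length (filter (∁? P?) xs))     ≡⟨ sym (+-suc _ _) ⟩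
  length (filter P? xs) + suc (length (filter (∁? P?) xs))     ∎
  where open ≡-Reasoning

length-cartesianProductWith : {C : Set c} (f : A → B → C) (xs : List A) (ys : List B) →
                              length (cartesianProductWith f xs ys) ≡ length xs * length ys
length-cartesianProductWith f []       ys = refl
length-cartesianProductWith f (x ∷ xs) ys = begin
  length (L.map (f x) ys ++ cartesianProductWith f xs ys)          ≡⟨ length-++ (L.map (f x) ys) ⟩
  length (L.map (f x) ys) + length (cartesianProductWith f xs ys)  ≡⟨ cong₂ _+_ (length-map (f x) ys)
                                                                                (length-cartesianProductWith f xs ys) ⟩
  length ys + length xs * length ys                                ∎
  where open ≡-Reasoning

module Pigeonhole {A : Set a} {B : Set b} (_≟_ : DecidableEquality B) (label : A → B) where

  labelled : B → List A → List A
  labelled β = filter (λ x → label x ≟ β)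

  unlabelled : B → List A → List A
  unlabelled β = filter (∁? (λ x → label x ≟ β))

  length-labelled-unlabelled : ∀ β γ xs → length (labelled γ (unlabelled β xs)) ≤ length (labelled γ xs)
  length-labelled-unlabelled β γ xs =
    length-mono-≤ (filter⁺ (λ x → label x ≟ γ) (λ x → label x ≟ γ) (λ { refl q → q })
                           (filter-⊆ (∁? (λ x → label x ≟ β)) xs))

  unlabelled-covered : ∀ {β βs xs} → (∀ {x} → x ∈ xs → label x ∈ β ∷ βs) →
                       ∀ {x} → x ∈ unlabelled β xs → label x ∈ βs
  unlabelled-covered {β} covered x∈ with x∈xs , ℓx≢β ← ∈-filter⁻ (∁? (λ x → label x ≟ β)) x∈
                                    with covered x∈xs
  ... | here ℓx≡β   = contradiction ℓx≡β ℓx≢β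
  ... | there ℓx∈βs = ℓx∈βs

  length-≤-labelled+unlabelled : ∀ β γ k xs →
    length (unlabelled β xs) ≤ k * length (labelled γ (unlabelled β xs)) →
    length xs ≤ length (labelled β xs) + k * length (labelled γ xs)
  length-≤-labelled+unlabelled β γ k xs rest≤ = begin
    length xs                                                 ≡⟨ length-filter-split (λ x → label x ≟ β) xs ⟩
    length (labelled β xs) + length (unlabelled β xs)         ≤⟨ +-monoʳ-≤ _ rest≤ ⟩
    length (labelled β xs) + k * length (labelled γ (unlabelled β xs))
                                                              ≤⟨ +-monoʳ-≤ _ (*-monoʳ-≤ k (length-labelled-unlabelled β γ xs)) ⟩
    length (labelled β xs) + k * length (labelled γ xs)       ∎
    where open ≤-Reasoning

  -- β₀ is returned only when there is nothing to count (no labels and no elements).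
  pigeonhole : (βs : List B) (xs : List A) → (∀ {x} → x ∈ xs → label x ∈ βs) → B →
               Σ B λ β → length xs ≤ length βs * length (labelled β xs)
  pigeonhole []       []      _       β₀ = β₀ , z≤n
  pigeonhole []       (x ∷ _) covered _  = contradiction (covered (here refl)) λ ()
  pigeonhole (β ∷ βs) xs      covered β₀
    with γ , rest≤ ← pigeonhole βs (unlabelled β xs) (unlabelled-covered covered) β₀
    with bound ← length-≤-labelled+unlabelled β γ (length βs) xs rest≤
    with ≤-total (length (labelled β xs)) (length (labelled γ xs))
  ... | inj₁ nβ≤nγ = γ , ≤-trans bound (+-monoˡ-≤ _ nβ≤nγ)
  ... | inj₂ nγ≤nβ = β , ≤-trans bound (+-monoʳ-≤ _ (*-monoʳ-≤ (length βs) nγ≤nβ))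

tuples : ∀ d r → List (Tuple d r)
tuples d zero    = [] ∷ []
tuples d (suc r) = cartesianProductWith _∷_ (allFin d) (tuples d r)

∈-tuples : ∀ {d r} (t : Tuple d r) → t ∈ tuples d r
∈-tuples []      = here refl
∈-tuples (i ∷ t) = ∈-cartesianProductWith⁺ _∷_ (∈-allFin i) (∈-tuples t)

length-tuples : ∀ d r → length (tuples d r) ≡ d ^ r
length-tuples d zero    = refl
length-tuples d (suc r) = begin
  length (cartesianProductWith _∷_ (allFin d) (tuples d r)) ≡⟨ length-cartesianProductWith _∷_ (allFin d) (tuples d r) ⟩
  length (allFin d) * length (tuples d r)                   ≡⟨ cong₂ _*_ (length-tabulate {n = d} id) (length-tuples d r) ⟩
  d * d ^ r                                                 ∎
  where open ≡-Reasoning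

pigeonhole-tuples : ∀ {d r} (label : A → Tuple d r) (xs : List A) → Tuple d r →
                    Σ (Tuple d r) λ t → length xs ≤ d ^ r * length (Pigeonhole.labelled (Vec.≡-dec Fin._≟_) label t xs)
pigeonhole-tuples {d = d} {r} label xs t₀
  with t , xs≤ ← Pigeonhole.pigeonhole (Vec.≡-dec Fin._≟_) label (tuples d r) xs (λ {x} _ → ∈-tuples (label x)) t₀
  = t , subst (λ k → length xs ≤ k * length (labelled t xs)) (length-tuples d r) xs≤
  where open Pigeonhole (Vec.≡-dec Fin._≟_) label using (labelled)

NonRedundant-mono : ∀ {d r} {R S S′ : Rel d r} {n Y} → S ⊆ S′ →
                    NonRedundant R S n Y → NonRedundant R S′ n Y
NonRedundant-mono S⊆S′ (unique , isolating) = unique , λ y∈Y →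
  let σ , othersInR , σy∈S , σy∉R = isolating y∈Y in σ , othersInR , S⊆S′ σy∈S , σy∉R

∪⟨⟩-⊆ : ∀ {d r} {R S : Rel d r} {t} → R ⊆ S → S t → R ∪⟨ t ⟩ ⊆ S
∪⟨⟩-⊆ R⊆S St = [ R⊆S , (λ { refl → St }) ]

module ViolatedTuple {d r n} {R S : Rel d r} {Y : List (Vec (Fin n) r)}
                     (nonRedundant : NonRedundant R S n Y) (t₀ : Tuple d r) where

  open import Data.List.Membership.DecPropositional (Vec.≡-dec {n = r} (Fin._≟_ {n})) using (_∈?_)

  -- The tuple that the chosen witness assignment of y sends y to; t₀ is a junk value for y ∉ Y.
  violated : Vec (Fin n) r → Tuple d r
  violated y with y ∈? Y
  ... | yes y∈Y = map (proj₁ (proj₂ nonRedundant y∈Y)) y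
  ... | no  _   = t₀

  violated-witness : ∀ {y} → y ∈ Y → Σ (Fin n → Fin d) λ σ →
    (∀ {y′} → y′ ∈ Y → y′ ≢ y → R (map σ y′)) × map σ y ≡ violated y × S (violated y) × ¬ R (violated y)
  violated-witness {y} y∈Y with y ∈? Y
  ... | yes y∈Y′ = let σ , othersInR , σy∈S , σy∉R = proj₂ nonRedundant y∈Y′
                   in σ , othersInR , refl , σy∈S , σy∉R
  ... | no  y∉Y  = contradiction y∈Y y∉Y

  violatedBy : Tuple d r → List (Vec (Fin n) r)
  violatedBy t = Pigeonhole.labelled (Vec.≡-dec Fin._≟_) violated t Y

  violatedBy-∈S∖R : ∀ {t y} → y ∈ violatedBy t → S t × ¬ R t
  violatedBy-∈S∖R {t} y∈ with y∈Y , refl ← ∈-filter⁻ (λ y → Vec.≡-dec Fin._≟_ (violated y) t) y∈ =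
    let _ , _ , _ , vy∈S , vy∉R = violated-witness y∈Y in vy∈S , vy∉R

  violatedBy-nonRedundant : ∀ t → NonRedundant R (R ∪⟨ t ⟩) n (violatedBy t)
  violatedBy-nonRedundant t = Unique.filter⁺ _ (proj₁ nonRedundant) , λ y∈ →
    let y∈Y , vy≡t = ∈-filter⁻ _ y∈
        σ , othersInR , σy≡vy , _ , vy∉R = violated-witness y∈Y
    in σ , (λ y′∈ → othersInR (proj₁ (∈-filter⁻ _ y′∈))) , inj₂ (trans σy≡vy vy≡t) ,
       subst (λ u → ¬ R u) (sym σy≡vy) vy∉R

proposition4p1 : (d r : ℕ) (R S : Rel d r) → R ⊆ S → Σ (Tuple d r) (λ t → S t × ¬ R t) →
    (n m : ℕ) (f : Tuple d r → ℕ) →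
    IsNRD R S n m →
    (∀ t → S t → ¬ R t → IsNRD R (R ∪⟨ t ⟩) n (f t)) →
    ((∀ t → S t → ¬ R t → f t ≤ m) ×
     Σ (Tuple d r) (λ t → S t × ¬ R t × m ≤ (d ^ r) * f t))
proposition4p1 d r R S R⊆S (t₀ , St₀ , ¬Rt₀) n m f ((Y , nrY , |Y|≡m) , maximal) nrd-t =
  lower , upper
  where
  open ViolatedTuple {R = R} {S = S} nrY t₀

  lower : ∀ t → S t → ¬ R t → f t ≤ m
  lower t St ¬Rt with (Z , nrZ , |Z|≡ft) , _ ← nrd-t t St ¬Rt =
    subst (_≤ m) |Z|≡ft (maximal Z (NonRedundant-mono {R = R} {S = R ∪⟨ t ⟩} (∪⟨⟩-⊆ R⊆S St) nrZ))

  violatedBy≤f : ∀ t → S t → ¬ R t → length (violatedBy t) ≤ f t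
  violatedBy≤f t St ¬Rt = proj₂ (nrd-t t St ¬Rt) (violatedBy t) (violatedBy-nonRedundant t)

  upper-from : ∀ t → m ≤ d ^ r * length (violatedBy t) →
               Σ (Tuple d r) (λ t → S t × ¬ R t × m ≤ (d ^ r) * f t)
  -- An empty class forces m = 0, and then the given tuple t₀ ∈ S ∖ R will do.
  upper-from t with violatedBy t | violatedBy-∈S∖R {t} | violatedBy≤f t
  ... | []    | _    | _       = λ m≤ → t₀ , St₀ , ¬Rt₀ , ≤-trans m≤ (*-monoʳ-≤ (d ^ r) z≤n)
  ... | y ∷ _ | ∈S∖R | class≤f = λ m≤ →
    let St , ¬Rt = ∈S∖R (here refl) in t , St , ¬Rt , ≤-trans m≤ (*-monoʳ-≤ (d ^ r) (class≤f St ¬Rt))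

  upper : Σ (Tuple d r) (λ t → S t × ¬ R t × m ≤ (d ^ r) * f t)
  upper with t , |Y|≤ ← pigeonhole-tuples violated Y t₀ = upper-from t (subst (_≤ _) |Y|≡m |Y|≤)
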